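{- Let $a,p$ be positive integers with $\gcd(a,p)=1$ and $a<p$, and let $r$ be a nonnegative integer. Put $N=p^2r+pa=p(pr+a)$. For a positive integer $n$, let $\tilde{A}(n)$ be the set of partitions of $n$ in which, for each $j=0,1,\ldots,p-1$, every multiplicity congruent to $ja \pmod p$ is at least $j(pr+a)$; and let $\tilde{B}(n)$ be the set of partitions of $n$ in which every part not divisible by $p$ is congruent to $-s(pr+a)\pmod{N}$ for some $s\in\{1,2,\ldots,p-1\}$. Given $\lambda\in\tilde{A}(n)$, let $h_i$ denote the multiplicity of $i$ in $\lambda$ ($i\ge 1$). Let $v_i\in\{0,1,\ldots,p-1\}$ be the residue of $a^{ -1}h_i$ modulo $p$ (where $a^{ -1}$ is the inverse of $a$ modulo $p$), and set $k_i=(pr+a)v_i$ and $g_i=h_i-k_i$ (so $k_i\in\{0,pr+a,\ldots,(p-1)(pr+a)\}$ and $g_i\in\{0,p,2p,\ldots\}$). For each positive integer $x$ define $$d_x=\begin{cases} 0, & \text{if } p\nmid x \text{ and } (pr+a)\nmid x,\\[2pt] \tfrac{1}{p}\,g_{x/p}, & \text{if } p\mid x \text{ and } (pr+a)\nmid x,\\[2pt] \tfrac{1}{pr+a}\,k_{m}+g_{x}, & \text{if } x=(pr+a)m \text{ with } m\ge 1.\end{cases}$$ Let $\phi(\lambda)=\mu$ be the partition in which each positive integer $x$ appears with multiplicity $d_x$. Then for every $n$, $\phi(\lambda)\in\tilde{B}(n)$ for all $\lambda\in\tilde{A}(n)$, and $\phi:\tilde{A}(n)\to\tilde{B}(n)$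 is a bijection.
   Context: A partition of $n$ is a finite multiset of positive integers (parts) summing to $n$; the multiplicity of a positive integer $i$ is the number of times $i$ occurs as a part (possibly $0$). The definition of $d_x$ above is a case-by-case rewriting of the paper's definition: $d_{Nt+pj-ia}=0$ for $1\le i\le p-1$, $j\in\{1,\ldots,pr+a\}\setminus\{(p-i)r+a\}$; $d_{Nt+pj}=\frac1p g_{(pr+a)t+j}$ for $j=1,\ldots,pr+a-1$; and $d_{Nt+(p-j)(pr+a)}=\frac{1}{pr+a}k_{pt+p-j}+g_{Nt+(pr+a)(p-j)}$ for $j=1,\ldots,p$, with $t\ge0$. -}

module Defs where

open import Data.Nat using (ℕ; zero; suc; _+_; _*_; _∸_; _≤_; _<_; NonZero)
open import Data.Nat.DivMod using (_/_; _%_)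
open import Data.Nat.Divisibility using (_∣_; _∣?_; divides)
open import Data.Product using (Σ; _×_)
open import Relation.Nullary using (¬_; yes; no)
open import Relation.Binary.PropositionalEquality using (_≡_)

-- A partition is represented by its multiplicity function  h : ℕ → ℕ,
-- where h i is the multiplicity of the part i (only i ≥ 1 matters;
-- the value at 0 is ignored everywhere).

weight : (ℕ → ℕ) → ℕ → ℕ
weight h zero    = 0
weight h (suc n) = weight h n + suc n * h (suc n)

IsPartition : ℕ → (ℕ → ℕ) → Set
IsPartition n h = (∀ i → n < i → h i ≡ 0) × weight h n ≡ n

SamePartition : (ℕ → ℕ) → (ℕ → ℕ) → Set
SamePartition h h' = ∀ i → 1 ≤ i → h i ≡ h' i

module _ (a p r : ℕ) ⦃ _ : NonZero p ⦄ where

  q : ℕ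
  q = p * r + a

  N : ℕ
  N = p * q

  InA : (ℕ → ℕ) → Set
  InA h = ∀ i → 1 ≤ i → ∀ j → j < p → h i % p ≡ (j * a) % p → j * q ≤ h i

  -- B̃(n) condition: every part x (i.e. x ≥ 1 with nonzero multiplicity)
  -- not divisible by p is ≡ -s(pr+a) (mod N) for some s ∈ {1,…,p-1},
  -- i.e. N ∣ x + s(pr+a).
  InB : (ℕ → ℕ) → Set
  InB μ = ∀ x → 1 ≤ x → ¬ (μ x ≡ 0) → ¬ (p ∣ x) →
          Σ ℕ (λ s → 1 ≤ s × s ≤ p ∸ 1 × N ∣ x + s * q)

  -- The map φ; ainv is an inverse of a modulo p.
  module _ (ainv : ℕ) (h : ℕ → ℕ) where

    v : ℕ → ℕ
    v i = (ainv * h i) % p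

    k : ℕ → ℕ
    k i = q * v i

    g : ℕ → ℕ
    g i = h i ∸ k i

    -- d x; in the third case k m / (pr+a) is written as v m (k m = (pr+a) v m).
    d : ℕ → ℕ
    d x with q ∣? x
    ... | yes (divides m _) = v m + g x
    ... | no _ with p ∣? x
    ...   | yes (divides y _) = g y / p
    ...   | no _ = 0

  φ : ℕ → (ℕ → ℕ) → (ℕ → ℕ)
  φ ainv h = d ainv h

-- Write h_i = g_i + q v_i with v_i < p.  Membership in Ã(n) says exactly that q v_i ≤ h_i,
-- and then h_i ≡ a v_i ≡ q v_i (mod p) gives p ∣ g_i.  Hence φ(h) is the sum of three
-- pieces: v dilated by q, the g_i with q ∤ i divided by p and dilated by p, and the g_i with
-- q ∣ i left in place; each piece has the weight of its share of h, so φ preserves weight.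
-- A part of φ(h) not divisible by p is some m q with p ∤ m, and s = p - (m mod p) gives
-- N ∣ m q + s q.  Since gcd(p, q) = 1, the map is inverted by reading v_i as μ_{iq} mod p
-- and g_i as p ⌊μ_i / p⌋ if q ∣ i and as p μ_{ip} otherwise.

module Submission where

open import Defs
open import Data.Nat
open import Data.Nat.Properties
open import Data.Nat.Divisibility
open import Data.Nat.DivMod
open import Data.Empty using (⊥-elim)
open import Data.Sum using (inj₁; inj₂)
open import Data.Product using (Σ; _×_; _,_; proj₁; proj₂)
open import Relation.Nullary using (¬_; Dec; yes; no; ¬?)
open import Data.Nat.GCD using (gcd)
open import Data.Nat.Coprimality using (Coprime; gcd≡1⇒coprime; coprime-divisor)
open import Relation.Binary.PropositionalEquality
open import Data.Nat.Tactic.RingSolver using (solve-∀)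

weight-cong : ∀ {f g : ℕ → ℕ} n → (∀ i → 1 ≤ i → i ≤ n → f i ≡ g i) → weight f n ≡ weight g n
weight-cong zero    f≗g = refl
weight-cong (suc n) f≗g =
  cong₂ _+_ (weight-cong n (λ i 1≤i i≤n → f≗g i 1≤i (m≤n⇒m≤1+n i≤n)))
            (cong (suc n *_) (f≗g (suc n) (s≤s z≤n) ≤-refl))

weight-+ : ∀ f g n → weight (λ i → f i + g i) n ≡ weight f n + weight g n
weight-+ f g zero    = refl
weight-+ f g (suc n) rewrite weight-+ f g n =
  lemma (weight f n) (weight g n) (suc n) (f (suc n)) (g (suc n))
  where
  lemma : ∀ A B s x y → A + B + s * (x + y) ≡ (A + s * x) + (B + s * y)
  lemma = solve-∀

weight-*ˡ : ∀ c f n → weight (λ i → c * f i) n ≡ c * weight f n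
weight-*ˡ c f zero    = sym (*-zeroʳ c)
weight-*ˡ c f (suc n) rewrite weight-*ˡ c f n = lemma c (weight f n) (suc n) (f (suc n))
  where
  lemma : ∀ c A s x → c * A + s * (c * x) ≡ c * (A + s * x)
  lemma = solve-∀

weight-vanishing : ∀ f {n m} → n ≤ m → (∀ i → n < i → i ≤ m → f i ≡ 0) → weight f m ≡ weight f n
weight-vanishing f n≤m = go (≤⇒≤′ n≤m)
  where
  go : ∀ {n m} → n ≤′ m → (∀ i → n < i → i ≤ m → f i ≡ 0) → weight f m ≡ weight f n
  go ≤′-refl          _      = refl
  go {n} {suc m} (≤′-step n≤′m) vanish = begin
    weight f m + suc m * f (suc m)
      ≡⟨ cong (λ z → weight f m + suc m * z) (vanish (suc m) (s≤s (≤′⇒≤ n≤′m)) ≤-refl) ⟩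
    weight f m + suc m * 0         ≡⟨ cong (weight f m +_) (*-zeroʳ (suc m)) ⟩
    weight f m + 0                 ≡⟨ +-identityʳ _ ⟩
    weight f m                     ≡⟨ go n≤′m (λ i n<i i≤m → vanish i n<i (m≤n⇒m≤1+n i≤m)) ⟩
    weight f n                     ∎
    where open ≡-Reasoning

*-≤-weight : ∀ f {i n} → i ≤ n → i * f i ≤ weight f n
*-≤-weight f {zero}      _ = z≤n
*-≤-weight f {suc i} {suc n} i≤n with m≤n⇒m<n∨m≡n i≤n
... | inj₂ refl         = m≤n+m _ (weight f n)
... | inj₁ (s≤s i<n)    = ≤-trans (*-≤-weight f i<n) (m≤m+n _ _)

i*hᵢ≤n : ∀ {n h} → IsPartition n h → ∀ i → i * h i ≤ n
i*hᵢ≤n {n} {h} (vanish , weight≡n) i with i ≤? n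
... | yes i≤n = subst (i * h i ≤_) weight≡n (*-≤-weight h i≤n)
... | no  i≰n rewrite vanish i (≰⇒> i≰n) | *-zeroʳ i = z≤n

m*n≤o<n⇒m≡0 : ∀ m {n o} → m * n ≤ o → o < n → m ≡ 0
m*n≤o<n⇒m≡0 zero    _      _   = refl
m*n≤o<n⇒m≡0 (suc m) {n} m*n≤o o<n = ⊥-elim (<⇒≱ o<n (≤-trans (m≤m+n n (m * n)) m*n≤o))

select : ∀ {P : Set} → Dec P → ℕ → ℕ
select (yes _) x = x
select (no _)  _ = 0

select-yes : ∀ {P : Set} (P? : Dec P) → P → ∀ x → select P? x ≡ x
select-yes (yes _) _  _ = refl
select-yes (no ¬P) P  _ = ⊥-elim (¬P P)

select-no : ∀ {P : Set} (P? : Dec P) → ¬ P → ∀ x → select P? x ≡ 0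
select-no (yes P) ¬P _ = ⊥-elim (¬P P)
select-no (no _)  _  _ = refl

select+select¬ : ∀ {P : Set} (P? : Dec P) x → select P? x + select (¬? P?) x ≡ x
select+select¬ (yes _) x = +-identityʳ x
select+select¬ (no _)  x = refl

dilate : (c : ℕ) ⦃ _ : NonZero c ⦄ → (ℕ → ℕ) → ℕ → ℕ
dilate c u x = select (c ∣? x) (u (x / c))

module _ (c : ℕ) ⦃ _ : NonZero c ⦄ (u : ℕ → ℕ) where

  dilate-* : ∀ {x} m → x ≡ m * c → dilate c u x ≡ u m
  dilate-* m refl = trans (select-yes (c ∣? m * c) (n∣m*n m) _) (cong u (m*n/n≡m m c))

  dilate-∤ : ∀ {x} → ¬ c ∣ x → dilate c u x ≡ 0
  dilate-∤ {x} c∤x = select-no (c ∣? x) c∤x _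

  dilate-vanishing : ∀ {x} → (∀ m → x ≡ m * c → u m ≡ 0) → dilate c u x ≡ 0
  dilate-vanishing {x} u≡0 with c ∣? x
  ... | yes (divides m x≡m*c) = trans (cong u (trans (cong (_/ c) x≡m*c) (m*n/n≡m m c))) (u≡0 m x≡m*c)
  ... | no _                  = refl

  ∤-between-multiples : ∀ {n i} → c * n < i → i < c * suc n → ¬ c ∣ i
  ∤-between-multiples {n} cn<i i<c[1+n] (divides k refl) =
    <⇒≱ i<c[1+n] (subst (_≤ k * c) (*-comm (suc n) c) (*-monoˡ-≤ c n<k))
    where
    n<k : n < k
    n<k = *-cancelˡ-< c n k (subst (c * n <_) (*-comm k c) cn<i)

  weight-dilate : ∀ n → weight (dilate c u) (c * n) ≡ c * weight u n
  weight-dilate zero rewrite *-zeroʳ c = refl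
  weight-dilate (suc n) = begin
    weight (dilate c u) (c * suc n)
      ≡⟨ cong (weight (dilate c u)) c[1+n]≡1+ℓ ⟩
    weight (dilate c u) ℓ + suc ℓ * dilate c u (suc ℓ)
      ≡⟨ cong₂ _+_ (weight-vanishing (dilate c u) (m≤m+n _ _) gap)
                   (cong₂ _*_ (sym c[1+n]≡1+ℓ) (dilate-* (suc n) (trans (sym c[1+n]≡1+ℓ) (*-comm c (suc n))))) ⟩
    weight (dilate c u) (c * n) + c * suc n * u (suc n)
      ≡⟨ cong (_+ c * suc n * u (suc n)) (weight-dilate n) ⟩
    c * weight u n + c * suc n * u (suc n)
      ≡⟨ lemma c (weight u n) (suc n) (u (suc n)) ⟩
    c * (weight u n + suc n * u (suc n)) ∎
    where
    open ≡-Reasoning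
    lemma : ∀ c A s x → c * A + c * s * x ≡ c * (A + s * x)
    lemma = solve-∀
    ℓ : ℕ
    ℓ = c * n + pred c
    c[1+n]≡1+ℓ : c * suc n ≡ suc ℓ
    c[1+n]≡1+ℓ = begin
      c * suc n           ≡⟨ *-suc c n ⟩
      c + c * n           ≡⟨ +-comm c (c * n) ⟩
      c * n + c           ≡⟨ cong (c * n +_) (sym (suc-pred c)) ⟩
      c * n + suc (pred c) ≡⟨ +-suc (c * n) (pred c) ⟩
      suc (c * n + pred c) ∎
    gap : ∀ i → c * n < i → i ≤ ℓ → dilate c u i ≡ 0
    gap i cn<i i≤ = dilate-∤ (∤-between-multiples cn<i (subst (i <_) (sym c[1+n]≡1+ℓ) (s≤s i≤)))

  weight-dilate-vanishing : ∀ n → (∀ x → n < x → dilate c u x ≡ 0) →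
                            weight (dilate c u) n ≡ c * weight u n
  weight-dilate-vanishing n vanish =
    trans (sym (weight-vanishing (dilate c u) (m≤n*m n c) (λ x n<x _ → vanish x n<x))) (weight-dilate n)

module _ (d : ℕ) ⦃ _ : NonZero d ⦄ where

  %≡%⇒∣∸ : ∀ {m n} → m % d ≡ n % d → n ≤ m → d ∣ m ∸ n
  %≡%⇒∣∸ {m} {n} m≡n n≤m = divides (m / d ∸ n / d) (begin
    m ∸ n
      ≡⟨ cong₂ _∸_ (m≡m%n+[m/n]*n m d) (trans (m≡m%n+[m/n]*n n d) (cong (_+ n / d * d) (sym m≡n))) ⟩
    (m % d + m / d * d) ∸ (m % d + n / d * d) ≡⟨ [m+n]∸[m+o]≡n∸o (m % d) _ _ ⟩
    m / d * d ∸ n / d * d                     ≡⟨ sym (*-distribʳ-∸ d (m / d) (n / d)) ⟩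
    (m / d ∸ n / d) * d                       ∎)
    where open ≡-Reasoning

  %-cong-*ˡ : ∀ c {x y} → x % d ≡ y % d → (c * x) % d ≡ (c * y) % d
  %-cong-*ˡ c {x} {y} x≡y = begin
    (c * x) % d               ≡⟨ %-distribˡ-* c x d ⟩
    ((c % d) * (x % d)) % d   ≡⟨ cong (λ z → ((c % d) * z) % d) x≡y ⟩
    ((c % d) * (y % d)) % d   ≡⟨ %-distribˡ-* c y d ⟨
    (c * y) % d               ∎
    where open ≡-Reasoning

  ∤⇒next-multiple : ∀ {m} → ¬ d ∣ m → Σ ℕ λ s → 1 ≤ s × s ≤ d ∸ 1 × d ∣ m + s
  ∤⇒next-multiple {m} d∤m =
    d ∸ m % d ,
    m<n⇒0<n∸m (m%n<n m d) ,
    ∸-monoʳ-≤ d (n≢0⇒n>0 (λ m%d≡0 → d∤m (m%n≡0⇒n∣m m d m%d≡0))) ,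
    divides (m / d + 1) (begin
      m + (d ∸ m % d)                   ≡⟨ cong (_+ (d ∸ m % d)) (m≡m%n+[m/n]*n m d) ⟩
      m % d + m / d * d + (d ∸ m % d)   ≡⟨ lemma (m % d) (m / d * d) (d ∸ m % d) ⟩
      m / d * d + (m % d + (d ∸ m % d)) ≡⟨ cong (m / d * d +_) (m+[n∸m]≡n (<⇒≤ (m%n<n m d))) ⟩
      m / d * d + d                     ≡⟨ lemma′ (m / d) d ⟩
      (m / d + 1) * d                   ∎)
    where
    open ≡-Reasoning
    lemma : ∀ x y z → x + y + z ≡ y + (x + z)
    lemma = solve-∀
    lemma′ : ∀ x d → x * d + d ≡ (x + 1) * d
    lemma′ = solve-∀

module Construction (a p r : ℕ) ⦃ _ : NonZero p ⦄ (1≤a : 1 ≤ a) (gcd[a,p]≡1 : gcd a p ≡ 1)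
                    (ainv : ℕ) (a*ainv≡1 : (a * ainv) % p ≡ 1) where

  Q : ℕ
  Q = q a p r

  instance
    Q-nonZero : NonZero Q
    Q-nonZero = >-nonZero (≤-trans 1≤a (m≤n+m a (p * r)))

  Q-coprime-p : Coprime Q p
  Q-coprime-p (c∣Q , c∣p) = gcd≡1⇒coprime gcd[a,p]≡1 (∣m+n∣m⇒∣n c∣Q (∣m⇒∣m*n r c∣p) , c∣p)

  Q∣y*p⇒Q∣y : ∀ y → Q ∣ y * p → Q ∣ y
  Q∣y*p⇒Q∣y y Q∣y*p = coprime-divisor Q-coprime-p (subst (Q ∣_) (*-comm y p) Q∣y*p)

  Q*w≡w*a : ∀ w → (Q * w) % p ≡ (w * a) % p
  Q*w≡w*a w = trans (cong (_% p) (lemma w p r a)) ([m+kn]%n≡m%n (w * a) (r * w) p)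
    where
    lemma : ∀ w p r a → (p * r + a) * w ≡ w * a + r * w * p
    lemma = solve-∀

  a*ainv*x≡x : ∀ x → (a * ainv * x) % p ≡ x % p
  a*ainv*x≡x x = begin
    (a * ainv * x) % p                 ≡⟨ %-distribˡ-* (a * ainv) x p ⟩
    (((a * ainv) % p) * (x % p)) % p   ≡⟨ cong (λ z → (z * (x % p)) % p) a*ainv≡1 ⟩
    (1 * (x % p)) % p                  ≡⟨ cong (_% p) (*-identityˡ (x % p)) ⟩
    x % p % p                          ≡⟨ m%n%n≡m%n x p ⟩
    x % p                              ∎
    where open ≡-Reasoning

  ainv*x≡j : ∀ {x j} → j < p → x % p ≡ (j * a) % p → (ainv * x) % p ≡ j
  ainv*x≡j {x} {j} j<p x≡j*a = begin
    (ainv * x) % p         ≡⟨ %-cong-*ˡ p ainv x≡j*a ⟩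
    (ainv * (j * a)) % p   ≡⟨ cong (_% p) (lemma ainv j a) ⟩
    (a * ainv * j) % p     ≡⟨ a*ainv*x≡x j ⟩
    j % p                  ≡⟨ m<n⇒m%n≡m j<p ⟩
    j                      ∎
    where
    open ≡-Reasoning
    lemma : ∀ ainv j a → ainv * (j * a) ≡ a * ainv * j
    lemma = solve-∀

  data Position (x : ℕ) : Set where
    Q-multiple : ∀ m → x ≡ m * Q → Position x
    p-multiple : ∀ y → ¬ Q ∣ x → x ≡ y * p → Position x
    elsewhere  : ¬ Q ∣ x → ¬ p ∣ x → Position x

  position : ∀ x → Position x
  position x with Q ∣? x | p ∣? x
  ... | yes (divides m x≡m*Q) | _                     = Q-multiple m x≡m*Q
  ... | no Q∤x                | yes (divides y x≡y*p) = p-multiple y Q∤x x≡y*p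
  ... | no Q∤x                | no p∤x                = elsewhere Q∤x p∤x

  module Image (h : ℕ → ℕ) where

    V G D : ℕ → ℕ
    V = v a p r ainv h
    G = g a p r ainv h
    D = φ a p r ainv h

    V<p : ∀ i → V i < p
    V<p i = m%n<n _ p

    D-Q-multiple : ∀ {x} m → x ≡ m * Q → D x ≡ V m + G x
    D-Q-multiple {x} m x≡m*Q with Q ∣? x
    ... | yes (divides m′ x≡m′*Q) = cong (λ z → V z + G x) (*-cancelʳ-≡ m′ m Q (trans (sym x≡m′*Q) x≡m*Q))
    ... | no Q∤x                  = ⊥-elim (Q∤x (divides m x≡m*Q))

    D-p-multiple : ∀ {x} y → ¬ Q ∣ x → x ≡ y * p → D x ≡ G y / p
    D-p-multiple {x} y Q∤x x≡y*p with Q ∣? x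
    ... | yes Q∣x = ⊥-elim (Q∤x Q∣x)
    ... | no _ with p ∣? x
    ...   | yes (divides y′ x≡y′*p) = cong (λ z → G z / p) (*-cancelʳ-≡ y′ y p (trans (sym x≡y′*p) x≡y*p))
    ...   | no p∤x                  = ⊥-elim (p∤x (divides y x≡y*p))

    D-elsewhere : ∀ {x} → ¬ Q ∣ x → ¬ p ∣ x → D x ≡ 0
    D-elsewhere {x} Q∤x p∤x with Q ∣? x
    ... | yes Q∣x = ⊥-elim (Q∤x Q∣x)
    ... | no _ with p ∣? x
    ...   | yes p∣x = ⊥-elim (p∤x p∣x)
    ...   | no _    = refl

  ψ-residue ψ-quotient ψ : (ℕ → ℕ) → ℕ → ℕ
  ψ-residue μ i = μ (i * Q) % p
  ψ-quotient μ i with Q ∣? i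
  ... | yes _ = μ i / p
  ... | no _  = μ (i * p)
  ψ μ i = Q * ψ-residue μ i + p * ψ-quotient μ i

  ψ-quotient-∣ : ∀ μ {i} → Q ∣ i → ψ-quotient μ i ≡ μ i / p
  ψ-quotient-∣ μ {i} Q∣i with Q ∣? i
  ... | yes _  = refl
  ... | no Q∤i = ⊥-elim (Q∤i Q∣i)

  ψ-quotient-∤ : ∀ μ {i} → ¬ Q ∣ i → ψ-quotient μ i ≡ μ (i * p)
  ψ-quotient-∤ μ {i} Q∤i with Q ∣? i
  ... | yes Q∣i = ⊥-elim (Q∤i Q∣i)
  ... | no _    = refl

  ψ-cong : ∀ {μ μ′} → SamePartition μ μ′ → SamePartition (ψ μ) (ψ μ′)
  ψ-cong {μ} {μ′} μ≗μ′ i 1≤i =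
    cong₂ _+_ (cong (λ z → Q * (z % p)) (μ≗μ′ (i * Q) (≤-trans 1≤i (m≤m*n i Q)))) (cong (p *_) quotient≡)
    where
    quotient≡ : ψ-quotient μ i ≡ ψ-quotient μ′ i
    quotient≡ with Q ∣? i
    ... | yes _ = cong (_/ p) (μ≗μ′ i 1≤i)
    ... | no _  = μ≗μ′ (i * p) (≤-trans 1≤i (m≤m*n i p))

  module Forward (h : ℕ → ℕ) (h∈A : InA a p r h) where
    open Image h

    V*a≡h : ∀ i → (V i * a) % p ≡ h i % p
    V*a≡h i = begin
      ((ainv * h i) % p * a) % p           ≡⟨ %-distribˡ-* ((ainv * h i) % p) a p ⟩
      ((ainv * h i) % p % p * (a % p)) % p ≡⟨ cong (λ z → (z * (a % p)) % p) (m%n%n≡m%n (ainv * h i) p) ⟩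
      ((ainv * h i) % p * (a % p)) % p     ≡⟨ %-distribˡ-* (ainv * h i) a p ⟨
      (ainv * h i * a) % p                 ≡⟨ cong (_% p) (lemma ainv (h i) a) ⟩
      (a * ainv * h i) % p                 ≡⟨ a*ainv*x≡x (h i) ⟩
      h i % p                              ∎
      where
      open ≡-Reasoning
      lemma : ∀ ainv x a → ainv * x * a ≡ a * ainv * x
      lemma = solve-∀

    Q*V≤h : ∀ i → 1 ≤ i → Q * V i ≤ h i
    Q*V≤h i 1≤i = subst (_≤ h i) (*-comm (V i) Q) (h∈A i 1≤i (V i) (V<p i) (sym (V*a≡h i)))

    p∣G : ∀ i → 1 ≤ i → p ∣ G i
    p∣G i 1≤i = %≡%⇒∣∸ p (trans (sym (V*a≡h i)) (sym (Q*w≡w*a (V i)))) (Q*V≤h i 1≤i)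

    h≡G+Q*V : ∀ i → 1 ≤ i → h i ≡ G i + Q * V i
    h≡G+Q*V i 1≤i = sym (m∸n+n≡m (Q*V≤h i 1≤i))

    G-on-Q G-off-Q G-off-Q/p : ℕ → ℕ
    G-on-Q  x = select (Q ∣? x) (G x)
    G-off-Q x = select (¬? (Q ∣? x)) (G x)
    G-off-Q/p y = G-off-Q y / p

    D≡dilations : ∀ x → D x ≡ dilate Q V x + (dilate p G-off-Q/p x + G-on-Q x)
    D≡dilations x with position x
    ... | Q-multiple m x≡m*Q = begin
      D x         ≡⟨ D-Q-multiple m x≡m*Q ⟩
      V m + G x   ≡⟨ cong₂ _+_ (sym (dilate-* Q V m x≡m*Q)) (sym (select-yes (Q ∣? x) Q∣x (G x))) ⟩
      dilate Q V x + G-on-Q x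
        ≡⟨ cong (λ z → dilate Q V x + (z + G-on-Q x)) (sym (dilate-vanishing p G-off-Q/p off-Q≡0)) ⟩
      dilate Q V x + (dilate p G-off-Q/p x + G-on-Q x) ∎
      where
      open ≡-Reasoning
      Q∣x : Q ∣ x
      Q∣x = divides m x≡m*Q
      off-Q≡0 : ∀ y → x ≡ y * p → G-off-Q/p y ≡ 0
      off-Q≡0 y x≡y*p =
        trans (cong (_/ p) (select-no (¬? (Q ∣? y)) (λ Q∤y → Q∤y (Q∣y*p⇒Q∣y y (subst (Q ∣_) x≡y*p Q∣x))) (G y)))
              (0/n≡0 p)
    ... | p-multiple y Q∤x x≡y*p = begin
      D x                    ≡⟨ D-p-multiple y Q∤x x≡y*p ⟩
      G y / p                ≡⟨ cong (_/ p) (sym (select-yes (¬? (Q ∣? y)) Q∤y (G y))) ⟩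
      G-off-Q/p y            ≡⟨ sym (dilate-* p G-off-Q/p y x≡y*p) ⟩
      dilate p G-off-Q/p x   ≡⟨ sym (+-identityʳ _) ⟩
      dilate p G-off-Q/p x + 0
        ≡⟨ cong₂ (λ z w → z + (dilate p G-off-Q/p x + w))
                 (sym (dilate-∤ Q V Q∤x)) (sym (select-no (Q ∣? x) Q∤x (G x))) ⟩
      dilate Q V x + (dilate p G-off-Q/p x + G-on-Q x) ∎
      where
      open ≡-Reasoning
      Q∤y : ¬ Q ∣ y
      Q∤y Q∣y = Q∤x (subst (Q ∣_) (sym x≡y*p) (∣m⇒∣m*n p Q∣y))
    ... | elsewhere Q∤x p∤x = sym (begin
      dilate Q V x + (dilate p G-off-Q/p x + G-on-Q x)
        ≡⟨ cong₂ _+_ (dilate-∤ Q V Q∤x) (cong₂ _+_ (dilate-∤ p G-off-Q/p p∤x) (select-no (Q ∣? x) Q∤x (G x))) ⟩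
      0   ≡⟨ sym (D-elsewhere Q∤x p∤x) ⟩
      D x ∎)
      where open ≡-Reasoning

    p∣G-off-Q : ∀ i → 1 ≤ i → p ∣ G-off-Q i
    p∣G-off-Q i 1≤i with Q ∣? i
    ... | yes _ = divides 0 refl
    ... | no _  = p∣G i 1≤i

    weight-h : ∀ n → weight h n ≡ weight G n + Q * weight V n
    weight-h n = begin
      weight h n                              ≡⟨ weight-cong n (λ i 1≤i _ → h≡G+Q*V i 1≤i) ⟩
      weight (λ i → G i + Q * V i) n          ≡⟨ weight-+ G (λ i → Q * V i) n ⟩
      weight G n + weight (λ i → Q * V i) n   ≡⟨ cong (weight G n +_) (weight-*ˡ Q V n) ⟩
      weight G n + Q * weight V n             ∎
      where open ≡-Reasoning

    weight-G-off-Q/p : ∀ n → p * weight G-off-Q/p n ≡ weight G-off-Q n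
    weight-G-off-Q/p n = trans (sym (weight-*ˡ p G-off-Q/p n)) (weight-cong n (λ i 1≤i _ → m*[n/m]≡n (p∣G-off-Q i 1≤i)))

    weight-G : ∀ n → weight G-off-Q n + weight G-on-Q n ≡ weight G n
    weight-G n = trans (sym (weight-+ G-off-Q G-on-Q n)) (weight-cong n (λ i _ _ →
      trans (+-comm (G-off-Q i) (G-on-Q i)) (select+select¬ (Q ∣? i) (G i))))

    weight-D : ∀ n → (∀ x → n < x → D x ≡ 0) → weight D n ≡ weight h n
    weight-D n D-vanishes = begin
      weight D n
        ≡⟨ weight-cong n (λ x _ _ → D≡dilations x) ⟩
      weight (λ x → dilate Q V x + (dilate p G-off-Q/p x + G-on-Q x)) n
        ≡⟨ weight-+ (dilate Q V) _ n ⟩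
      weight (dilate Q V) n + weight (λ x → dilate p G-off-Q/p x + G-on-Q x) n
        ≡⟨ cong (weight (dilate Q V) n +_) (weight-+ (dilate p G-off-Q/p) G-on-Q n) ⟩
      weight (dilate Q V) n + (weight (dilate p G-off-Q/p) n + weight G-on-Q n)
        ≡⟨ cong₂ (λ z w → z + (w + weight G-on-Q n))
                 (weight-dilate-vanishing Q V n (λ x n<x → m+n≡0⇒m≡0 _ (D≡0 x n<x)))
                 (weight-dilate-vanishing p G-off-Q/p n
                   (λ x n<x → m+n≡0⇒m≡0 _ (m+n≡0⇒n≡0 (dilate Q V x) (D≡0 x n<x)))) ⟩
      Q * weight V n + (p * weight G-off-Q/p n + weight G-on-Q n)
        ≡⟨ cong (λ z → Q * weight V n + (z + weight G-on-Q n)) (weight-G-off-Q/p n) ⟩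
      Q * weight V n + (weight G-off-Q n + weight G-on-Q n)
        ≡⟨ cong (Q * weight V n +_) (weight-G n) ⟩
      Q * weight V n + weight G n
        ≡⟨ +-comm _ (weight G n) ⟩
      weight G n + Q * weight V n
        ≡⟨ sym (weight-h n) ⟩
      weight h n ∎
      where
      open ≡-Reasoning
      D≡0 : ∀ x → n < x → dilate Q V x + (dilate p G-off-Q/p x + G-on-Q x) ≡ 0
      D≡0 x n<x = trans (sym (D≡dilations x)) (D-vanishes x n<x)

    D-vanishing : ∀ {n} → IsPartition n h → ∀ x → n < x → D x ≡ 0
    D-vanishing {n} h⊢n x n<x with position x
    ... | Q-multiple zero x≡0 = ⊥-elim (<⇒≢ (≤-<-trans z≤n n<x) (sym x≡0))
    ... | Q-multiple m@(suc _) x≡m*Q = trans (D-Q-multiple m x≡m*Q) (cong₂ _+_ V≡0 G≡0)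
      where
      G≡0 : G x ≡ 0
      G≡0 = trans (cong (_∸ Q * V x) (proj₁ h⊢n x n<x)) (0∸n≡0 (Q * V x))
      V≡0 : V m ≡ 0
      V≡0 = m*n≤o<n⇒m≡0 (V m) (begin
        V m * x         ≡⟨ cong (V m *_) x≡m*Q ⟩
        V m * (m * Q)   ≡⟨ lemma (V m) m Q ⟩
        m * (Q * V m)   ≤⟨ *-monoʳ-≤ m (Q*V≤h m (s≤s z≤n)) ⟩
        m * h m         ≤⟨ i*hᵢ≤n h⊢n m ⟩
        n               ∎) n<x
        where
        open ≤-Reasoning
        lemma : ∀ v m q → v * (m * q) ≡ m * (q * v)
        lemma = solve-∀
    ... | p-multiple y Q∤x x≡y*p = trans (D-p-multiple y Q∤x x≡y*p) (m*n≤o<n⇒m≡0 (G y / p) (begin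
        G y / p * x         ≡⟨ cong (G y / p *_) x≡y*p ⟩
        G y / p * (y * p)   ≡⟨ lemma (G y / p) y p ⟩
        y * (G y / p * p)   ≤⟨ *-monoʳ-≤ y (m/n*n≤m (G y) p) ⟩
        y * G y             ≤⟨ *-monoʳ-≤ y (m∸n≤m (h y) (Q * V y)) ⟩
        y * h y             ≤⟨ i*hᵢ≤n h⊢n y ⟩
        n                   ∎) n<x)
      where
      open ≤-Reasoning
      lemma : ∀ c y p → c * (y * p) ≡ y * (c * p)
      lemma = solve-∀
    ... | elsewhere Q∤x p∤x = D-elsewhere Q∤x p∤x

    D∈B : InB a p r D
    D∈B x _ D≢0 p∤x with position x
    ... | p-multiple y _ x≡y*p = ⊥-elim (p∤x (divides y x≡y*p))
    ... | elsewhere Q∤x p∤x′   = ⊥-elim (D≢0 (D-elsewhere Q∤x p∤x′))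
    ... | Q-multiple m x≡m*Q
      with ∤⇒next-multiple p {m} (λ p∣m → p∤x (subst (p ∣_) (sym x≡m*Q) (∣m⇒∣m*n Q p∣m)))
    ...   | s , 1≤s , s≤p∸1 , p∣m+s =
      s , 1≤s , s≤p∸1 , subst (p * Q ∣_) (sym x+s*Q≡[m+s]*Q) (*-monoˡ-∣ Q p∣m+s)
      where
      x+s*Q≡[m+s]*Q : x + s * Q ≡ (m + s) * Q
      x+s*Q≡[m+s]*Q = trans (cong (_+ s * Q) x≡m*Q) (sym (*-distribʳ-+ Q m s))

    φ⊢n : ∀ {n} → IsPartition n h → IsPartition n D
    φ⊢n h⊢n = D-vanishing h⊢n , trans (weight-D _ (D-vanishing h⊢n)) (proj₂ h⊢n)

    ψ-residue-D : ∀ i → 1 ≤ i → ψ-residue D i ≡ V i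
    ψ-residue-D i 1≤i = begin
      D (i * Q) % p           ≡⟨ cong (_% p) (D-Q-multiple i refl) ⟩
      (V i + G (i * Q)) % p   ≡⟨ %-remove-+ʳ (V i) (p∣G (i * Q) (≤-trans 1≤i (m≤m*n i Q))) ⟩
      V i % p                 ≡⟨ m<n⇒m%n≡m (V<p i) ⟩
      V i                     ∎
      where open ≡-Reasoning

    ψ-quotient-D : ∀ i → 1 ≤ i → ψ-quotient D i ≡ G i / p
    ψ-quotient-D i 1≤i with Q ∣? i
    ... | yes (divides m i≡m*Q) = begin
      D i / p               ≡⟨ cong (_/ p) (D-Q-multiple m i≡m*Q) ⟩
      (V m + G i) / p       ≡⟨ +-distrib-/-∣ʳ (V m) (p∣G i 1≤i) ⟩
      V m / p + G i / p     ≡⟨ cong (_+ G i / p) (m<n⇒m/n≡0 (V<p m)) ⟩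
      G i / p               ∎
      where open ≡-Reasoning
    ... | no Q∤i = D-p-multiple i (λ Q∣i*p → Q∤i (Q∣y*p⇒Q∣y i Q∣i*p)) refl

    ψ∘φ≡id : ∀ i → 1 ≤ i → ψ D i ≡ h i
    ψ∘φ≡id i 1≤i = begin
      Q * ψ-residue D i + p * ψ-quotient D i
        ≡⟨ cong₂ (λ z w → Q * z + p * w) (ψ-residue-D i 1≤i) (ψ-quotient-D i 1≤i) ⟩
      Q * V i + p * (G i / p)                ≡⟨ cong (Q * V i +_) (m*[n/m]≡n (p∣G i 1≤i)) ⟩
      Q * V i + G i                          ≡⟨ +-comm (Q * V i) (G i) ⟩
      G i + Q * V i                          ≡⟨ sym (h≡G+Q*V i 1≤i) ⟩
      h i                                    ∎
      where open ≡-Reasoning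

  module Backward (μ : ℕ → ℕ) (μ∈B : InB a p r μ) where
    open Image (ψ μ)

    V≡ψ-residue : ∀ i → V i ≡ ψ-residue μ i
    V≡ψ-residue i = ainv*x≡j (m%n<n _ p)
      (trans (%-remove-+ʳ (Q * ψ-residue μ i) (m∣m*n (ψ-quotient μ i))) (Q*w≡w*a (ψ-residue μ i)))

    G≡p*ψ-quotient : ∀ i → G i ≡ p * ψ-quotient μ i
    G≡p*ψ-quotient i = trans (cong (λ z → ψ μ i ∸ Q * z) (V≡ψ-residue i)) (m+n∸m≡n (Q * ψ-residue μ i) _)

    ψ∈A : InA a p r (ψ μ)
    ψ∈A i _ j j<p ψ≡j*a = begin
      j * Q                                    ≡⟨ cong (_* Q) (trans (sym (ainv*x≡j j<p ψ≡j*a)) (V≡ψ-residue i)) ⟩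
      ψ-residue μ i * Q                        ≡⟨ *-comm (ψ-residue μ i) Q ⟩
      Q * ψ-residue μ i                        ≤⟨ m≤m+n _ _ ⟩
      Q * ψ-residue μ i + p * ψ-quotient μ i   ∎
      where open ≤-Reasoning

    φ∘ψ≡id : ∀ x → 1 ≤ x → D x ≡ μ x
    φ∘ψ≡id x 1≤x with position x
    ... | Q-multiple m x≡m*Q = begin
      D x                                          ≡⟨ D-Q-multiple m x≡m*Q ⟩
      V m + G x                                    ≡⟨ cong₂ _+_ (V≡ψ-residue m) (G≡p*ψ-quotient x) ⟩
      μ (m * Q) % p + p * ψ-quotient μ x
        ≡⟨ cong₂ (λ z w → μ z % p + p * w) (sym x≡m*Q) (ψ-quotient-∣ μ (divides m x≡m*Q)) ⟩
      μ x % p + p * (μ x / p)                      ≡⟨ cong (μ x % p +_) (*-comm p (μ x / p)) ⟩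
      μ x % p + μ x / p * p                        ≡⟨ sym (m≡m%n+[m/n]*n (μ x) p) ⟩
      μ x                                          ∎
      where open ≡-Reasoning
    ... | p-multiple y Q∤x x≡y*p = begin
      D x                       ≡⟨ D-p-multiple y Q∤x x≡y*p ⟩
      G y / p                   ≡⟨ cong (_/ p) (G≡p*ψ-quotient y) ⟩
      p * ψ-quotient μ y / p    ≡⟨ cong (_/ p) (*-comm p _) ⟩
      ψ-quotient μ y * p / p    ≡⟨ m*n/n≡m (ψ-quotient μ y) p ⟩
      ψ-quotient μ y            ≡⟨ ψ-quotient-∤ μ (λ Q∣y → Q∤x (subst (Q ∣_) (sym x≡y*p) (∣m⇒∣m*n p Q∣y))) ⟩
      μ (y * p)                 ≡⟨ cong μ (sym x≡y*p) ⟩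
      μ x                       ∎
      where open ≡-Reasoning
    ... | elsewhere Q∤x p∤x = trans (D-elsewhere Q∤x p∤x) (sym μx≡0)
      where
      μx≡0 : μ x ≡ 0
      μx≡0 with μ x ≟ 0
      ... | yes μx≡0 = μx≡0
      ... | no μx≢0 with μ∈B x 1≤x μx≢0 p∤x
      ...   | s , _ , _ , N∣x+s*Q =
        ⊥-elim (Q∤x (∣m+n∣m⇒∣n (subst (Q ∣_) (+-comm x (s * Q)) (m*n∣⇒n∣ p Q N∣x+s*Q)) (n∣m*n s)))

    ψ-vanishing : ∀ {n} → (∀ i → n < i → μ i ≡ 0) → ∀ i → n < i → ψ μ i ≡ 0
    ψ-vanishing {n} μ-vanishes i n<i =
      trans (cong₂ (λ z w → Q * z + p * w) residue≡0 quotient≡0) (cong₂ _+_ (*-zeroʳ Q) (*-zeroʳ p))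
      where
      residue≡0 : ψ-residue μ i ≡ 0
      residue≡0 = trans (cong (_% p) (μ-vanishes (i * Q) (<-≤-trans n<i (m≤m*n i Q)))) (m<n⇒m%n≡m (>-nonZero⁻¹ p))
      quotient≡0 : ψ-quotient μ i ≡ 0
      quotient≡0 with Q ∣? i
      ... | yes _ = trans (cong (_/ p) (μ-vanishes i n<i)) (0/n≡0 p)
      ... | no _  = μ-vanishes (i * p) (<-≤-trans n<i (m≤m*n i p))

    ψ⊢n : ∀ {n} → IsPartition n μ → IsPartition n (ψ μ)
    ψ⊢n {n} (μ-vanishes , weight-μ≡n) = ψ-vanishing μ-vanishes , (begin
      weight (ψ μ) n ≡⟨ sym (Forward.weight-D (ψ μ) ψ∈A n D-vanishing) ⟩
      weight D n     ≡⟨ weight-cong n (λ x 1≤x _ → φ∘ψ≡id x 1≤x) ⟩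
      weight μ n     ≡⟨ weight-μ≡n ⟩
      n              ∎)
      where
      open ≡-Reasoning
      D-vanishing : ∀ x → n < x → D x ≡ 0
      D-vanishing x n<x = trans (φ∘ψ≡id x (≤-trans (s≤s z≤n) n<x)) (μ-vanishes x n<x)

  φ-injective : ∀ {h h′} → InA a p r h → InA a p r h′ →
                SamePartition (φ a p r ainv h) (φ a p r ainv h′) → SamePartition h h′
  φ-injective {h} {h′} h∈A h′∈A φh≗φh′ i 1≤i =
    trans (sym (Forward.ψ∘φ≡id h h∈A i 1≤i)) (trans (ψ-cong φh≗φh′ i 1≤i) (Forward.ψ∘φ≡id h′ h′∈A i 1≤i))

mainTheorem1 : (a p r : ℕ) ⦃ _ : NonZero p ⦄ → 1 ≤ a → a < p → gcd a p ≡ 1 →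
    (ainv : ℕ) → (a * ainv) % p ≡ 1 →
    (n : ℕ) → 1 ≤ n →
    ((h : ℕ → ℕ) → IsPartition n h → InA a p r h →
      IsPartition n (φ a p r ainv h) × InB a p r (φ a p r ainv h))
    × ((h h' : ℕ → ℕ) → IsPartition n h → InA a p r h → IsPartition n h' → InA a p r h' →
      SamePartition (φ a p r ainv h) (φ a p r ainv h') → SamePartition h h')
    × ((μ : ℕ → ℕ) → IsPartition n μ → InB a p r μ →
      Σ (ℕ → ℕ) (λ h → IsPartition n h × InA a p r h × SamePartition (φ a p r ainv h) μ))
mainTheorem1 a p r 1≤a _ gcd[a,p]≡1 ainv a*ainv≡1 n _ =
    (λ h h⊢n h∈A → Forward.φ⊢n h h∈A h⊢n , Forward.D∈B h h∈A)
  , (λ h h′ _ h∈A _ h′∈A → φ-injective h∈A h′∈A)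
  , (λ μ μ⊢n μ∈B → ψ μ , Backward.ψ⊢n μ μ∈B μ⊢n , Backward.ψ∈A μ μ∈B , Backward.φ∘ψ≡id μ μ∈B)
  where open Construction a p r 1≤a gcd[a,p]≡1 ainv a*ainv≡1
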